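{- There is an infinite family of graphs $G$ whose number of minimal matching cuts is $\Omega(2^{\tau(G)})$.
   Context: $\tau(G)$ is the vertex cover number of $G$ (minimum size of a vertex set meeting every edge). A matching cut of $G$ is a (possibly empty) edge set $M$ that is a matching and equals $E(A,B)$ (edges between $A$ and $B$) for some partition $\{A,B\}$ of $V(G)$; it is minimal if no matching cut of $G$ is a proper subset of it. -}

module Defs where

open import Data.Nat using (ℕ; _≤_)
open import Data.Bool using (Bool; true; false)
open import Data.Fin using (Fin)
open import Data.Fin.Subset using (Subset; _∈_; ∣_∣)
open import Data.Product using (Σ; ∃; _×_; _,_)
open import Data.Sum using (_⊎_)
open import Relation.Binary.PropositionalEquality using (_≡_; _≢_)
open import Relation.Nullary using (¬_)

record Graph (n : ℕ) : Set where
  field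
    adj    : Fin n → Fin n → Bool
    sym    : ∀ i j → adj i j ≡ adj j i
    irrefl : ∀ i → adj i i ≡ false
open Graph public

Edge : ∀ {n} → Graph n → Fin n → Fin n → Set
Edge G i j = adj G i j ≡ true

IsVertexCover : ∀ {n} → Graph n → Subset n → Set
IsVertexCover G S = ∀ i j → Edge G i j → (i ∈ S) ⊎ (j ∈ S)

IsVertexCoverNumber : ∀ {n} → Graph n → ℕ → Set
IsVertexCoverNumber G t =
  (Σ _ λ S → IsVertexCover G S × ∣ S ∣ ≡ t) ×
  (∀ S → IsVertexCover G S → t ≤ ∣ S ∣)

-- Edge sets on Fin n, as symmetric relations (an unordered pair {i,j} is in M
-- iff M i j ≡ true).
EdgeSet : ℕ → Set
EdgeSet n = Fin n → Fin n → Bool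

InM : ∀ {n} → EdgeSet n → Fin n → Fin n → Set
InM M i j = M i j ≡ true

_⊆E_ : ∀ {n} → EdgeSet n → EdgeSet n → Set
M ⊆E M' = ∀ i j → InM M i j → InM M' i j

IsMatching : ∀ {n} → EdgeSet n → Set
IsMatching M = ∀ i j k → InM M i j → InM M i k → j ≡ k

-- M = E(A,B) for a partition {A,B} of V(G) into two nonempty parts;
-- side i ≡ true means i ∈ A, side i ≡ false means i ∈ B.
IsCutOf : ∀ {n} → Graph n → (Fin n → Bool) → EdgeSet n → Set
IsCutOf G side M =
  (∃ λ a → side a ≡ true) × (∃ λ b → side b ≡ false) ×
  (∀ i j → (InM M i j → Edge G i j × side i ≢ side j) ×
           (Edge G i j × side i ≢ side j → InM M i j))

IsMatchingCut : ∀ {n} → Graph n → EdgeSet n → Set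
IsMatchingCut G M = IsMatching M × (∃ λ side → IsCutOf G side M)

IsMinimalMatchingCut : ∀ {n} → Graph n → EdgeSet n → Set
IsMinimalMatchingCut G M =
  IsMatchingCut G M × (∀ M' → IsMatchingCut G M' → M' ⊆E M → M ⊆E M')

DifferentE : ∀ {n} → EdgeSet n → EdgeSet n → Set
DifferentE M M' = ¬ (∀ i j → M i j ≡ M' i j)

-- Join two hubs by k paths of length four and hang a pendant vertex on each hub.
-- The hubs and the k path middles cover every edge, while the two pendant edges
-- and one edge of each path form a matching, so τ = k + 2.  Give every vertex the
-- side of its nearest hub and each middle an arbitrary side: the 2 ^ k resulting
-- cuts take exactly one edge of every path, so they are matchings; each shore is
-- connected through its hub, so such a cut contains no other cut; and the cut
-- records the side of every middle.  Hence there are 2 ^ k = 2 ^ τ / 4 distinct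
-- minimal matching cuts.
module Submission where

open import Defs
open import Data.Nat using (ℕ; _≤_; _<_; _*_; _^_; zero; suc; _+_; s≤s)
open import Data.Nat.Properties using (≤-trans; ≤-reflexive; m≤n+m; +-identityʳ; ^-distribˡ-+-*)
open import Data.Fin using (Fin; zero; suc; _↑ʳ_)
open import Data.Fin.Properties using (_≟_)
open import Data.Fin.Subset using (Subset; inside; outside; _∈_; ∣_∣)
open import Data.Fin.Subset.Properties using (∣p∣≤∣x∷p∣; drop-there)
open import Data.Bool using (Bool; true; false; not; _∧_; _∨_; _xor_)
open import Data.Bool.Properties using (∨-comm; ¬-not; not-injective) renaming (_≟_ to _≟ᵇ_)
open import Data.Vec using (Vec; []; _∷_; lookup; tabulate; here; there)
open import Data.Vec.Properties using (∷-injectiveʳ; tabulate∘lookup; tabulate-cong)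
open import Data.List using (List; length; []; _∷_; map; _++_)
open import Data.List.Properties using (length-map; length-++)
open import Data.List.Relation.Unary.All as All using (All)
open import Data.List.Relation.Unary.All.Properties as All using ()
open import Data.List.Relation.Unary.AllPairs as AllPairs using (AllPairs; []; _∷_)
open import Data.List.Relation.Unary.AllPairs.Properties as AllPairs using ()
open import Data.Product using (Σ; _×_; _,_; proj₁; proj₂)
open import Data.Sum as Sum using (_⊎_; inj₁; inj₂)
open import Function using (_∘_)
open import Relation.Binary.Construct.Closure.ReflexiveTransitive using (Star; ε; _◅_; fold)
open import Relation.Binary.PropositionalEquality as ≡
  using (_≡_; _≢_; refl; trans; cong; cong₂; subst; subst₂; module ≡-Reasoning)
open import Relation.Nullary using (Dec; yes; no; does; contradiction)
open import Relation.Nullary.Decidable using (dec-true)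

does-true : ∀ {A : Set} (a? : Dec A) → does a? ≡ true → A
does-true (yes a) _ = a

∧-xor≡true⇔ : ∀ x y z →
  (x ∧ (y xor z) ≡ true → x ≡ true × y ≢ z) × (x ≡ true × y ≢ z → x ∧ (y xor z) ≡ true)
∧-xor≡true⇔ true  true  true  = (λ ()) , λ (_ , y≢z) → contradiction refl y≢z
∧-xor≡true⇔ true  true  false = (λ _ → refl , λ ()) , λ _ → refl
∧-xor≡true⇔ true  false true  = (λ _ → refl , λ ()) , λ _ → refl
∧-xor≡true⇔ true  false false = (λ ()) , λ (_ , y≢z) → contradiction refl y≢z
∧-xor≡true⇔ false y     z     = (λ ()) , λ ()

nonconstant⇒separates : ∀ (f : Bool → Bool) x → f x ≢ f (not x) → ∀ y → f y ≢ f (not y)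
nonconstant⇒separates f true  fx≢ true  = fx≢
nonconstant⇒separates f true  fx≢ false = fx≢ ∘ ≡.sym
nonconstant⇒separates f false fx≢ true  = fx≢ ∘ ≡.sym
nonconstant⇒separates f false fx≢ false = fx≢

module _ {n : ℕ} where

  fromArcs : (arc : Fin n → Fin n → Bool) → (∀ i → arc i i ≡ false) → Graph n
  fromArcs arc loopless = record
    { adj    = λ i j → arc i j ∨ arc j i
    ; sym    = λ i j → ∨-comm (arc i j) (arc j i)
    ; irrefl = λ i → cong₂ _∨_ (loopless i) (loopless i)
    }

  fromArcs-edge⁻ : ∀ arc loopless {i j} → Edge (fromArcs arc loopless) i j →
    arc i j ≡ true ⊎ arc j i ≡ true
  fromArcs-edge⁻ arc _ {i} {j} e with arc i j | arc j i
  ... | true  | _    = inj₁ refl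
  ... | false | true = inj₂ refl

  Edge-sym : ∀ (G : Graph n) {i j} → Edge G i j → Edge G j i
  Edge-sym G {i} {j} e = trans (Graph.sym G j i) e

  cutOf : Graph n → (Fin n → Bool) → EdgeSet n
  cutOf G side i j = adj G i j ∧ (side i xor side j)

  cutOf-isCut : ∀ G side → (Σ (Fin n) λ a → side a ≡ true) → (Σ (Fin n) λ b → side b ≡ false) →
    IsCutOf G side (cutOf G side)
  cutOf-isCut G side a b = a , b , λ i j → ∧-xor≡true⇔ (adj G i j) (side i) (side j)

  ShoreEdge : Graph n → (Fin n → Bool) → Fin n → Fin n → Set
  ShoreEdge G side u v = Edge G u v × side u ≡ side v

  connectedShores⇒minimalCut : ∀ G side (hub : Bool → Fin n) →
    (∀ v → Star (ShoreEdge G side) v (hub (side v))) →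
    ∀ side′ M′ → IsCutOf G side′ M′ → M′ ⊆E cutOf G side → cutOf G side ⊆E M′
  connectedShores⇒minimalCut G side hub walk side′ M′ ((a , a∈A) , (b , b∈B) , cut′) M′⊆M i j i~j =
    proj₂ (cut′ i j) (proj₁ crossing , λ eq → separates (side j) (begin
      σ (side j)       ≡⟨ ≡.sym (factors j) ⟩
      side′ j          ≡⟨ ≡.sym eq ⟩
      side′ i          ≡⟨ factors i ⟩
      σ (side i)       ≡⟨ cong σ (¬-not (proj₂ crossing)) ⟩
      σ (not (side j)) ∎))
    where
    open ≡-Reasoning

    crossing : Edge G i j × side i ≢ side j
    crossing = proj₁ (∧-xor≡true⇔ (adj G i j) (side i) (side j)) i~j

    σ : Bool → Bool
    σ s = side′ (hub s)

    preserved : ∀ {u v} → ShoreEdge G side u v → side′ u ≡ side′ v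
    preserved {u} {v} (e , same) with side′ u ≟ᵇ side′ v
    ... | yes eq = eq
    ... | no neq = contradiction same
      (proj₂ (proj₁ (∧-xor≡true⇔ _ (side u) (side v)) (M′⊆M u v (proj₂ (cut′ u v) (e , neq)))))

    factors : ∀ v → side′ v ≡ σ (side v)
    factors v = fold (λ u w → side′ u ≡ side′ w) (λ e eq → trans (preserved e) eq) refl (walk v)

    a≢b : side′ a ≢ side′ b
    a≢b eq = contradiction (trans (≡.sym a∈A) (trans eq b∈B)) λ ()

    shoresDiffer : side a ≢ side b
    shoresDiffer eq = a≢b (trans (factors a) (trans (cong σ eq) (≡.sym (factors b))))

    separates : ∀ s → σ s ≢ σ (not s)
    separates = nonconstant⇒separates σ (side b) λ eq → a≢b (begin
      side′ a          ≡⟨ factors a ⟩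
      σ (side a)       ≡⟨ cong σ (¬-not shoresDiffer) ⟩
      σ (not (side b)) ≡⟨ ≡.sym eq ⟩
      σ (side b)       ≡⟨ ≡.sym (factors b) ⟩
      side′ b          ∎)

booleanVectors : ∀ k → List (Vec Bool k)
booleanVectors zero    = [] ∷ []
booleanVectors (suc k) = map (true ∷_) (booleanVectors k) ++ map (false ∷_) (booleanVectors k)

length-booleanVectors : ∀ k → length (booleanVectors k) ≡ 2 ^ k
length-booleanVectors zero    = refl
length-booleanVectors (suc k) = begin
  length (map (true ∷_) vs ++ map (false ∷_) vs)         ≡⟨ length-++ (map (true ∷_) vs) ⟩
  length (map (true ∷_) vs) + length (map (false ∷_) vs) ≡⟨ cong₂ _+_ (length-map _ vs) (length-map _ vs) ⟩
  length vs + length vs                                   ≡⟨ cong (λ m → m + m) (length-booleanVectors k) ⟩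
  2 ^ k + 2 ^ k                                           ≡⟨ cong (2 ^ k +_) (≡.sym (+-identityʳ (2 ^ k))) ⟩
  2 ^ suc k                                               ∎
  where
  open ≡-Reasoning
  vs = booleanVectors k

booleanVectors-distinct : ∀ k → AllPairs _≢_ (booleanVectors k)
booleanVectors-distinct zero    = All.[] ∷ []
booleanVectors-distinct (suc k) = AllPairs.++⁺ (cons true) (cons false)
  (All.map⁺ (All.universal (λ _ → All.map⁺ (All.universal (λ _ ()) vs)) vs))
  where
  vs = booleanVectors k
  cons : ∀ x → AllPairs _≢_ (map (x ∷_) vs)
  cons x = AllPairs.map⁺ (AllPairs.map (λ u≢v → u≢v ∘ ∷-injectiveʳ) (booleanVectors-distinct k))

-- The i-th path is  hub true – port true i – middle i – port false i – hub false.
data Vertex (k : ℕ) : Set where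
  hub pendant : Bool → Vertex k
  port        : Bool → Fin k → Vertex k
  middle      : Fin k → Vertex k

lift : ∀ {k} → Vertex k → Vertex (suc k)
lift (hub s)      = hub s
lift (pendant s)  = pendant s
lift (port s i)   = port s (suc i)
lift (middle i)   = middle (suc i)

order : ℕ → ℕ
order zero    = 4
order (suc k) = 3 + order k

decode : ∀ k → Fin (order k) → Vertex k
decode zero    zero                   = hub true
decode zero    (suc zero)             = pendant true
decode zero    (suc (suc zero))       = hub false
decode zero    (suc (suc (suc zero))) = pendant false
decode (suc k) zero                   = port true zero
decode (suc k) (suc zero)             = middle zero
decode (suc k) (suc (suc zero))       = port false zero
decode (suc k) (suc (suc (suc v)))    = lift (decode k v)

encode : ∀ k → Vertex k → Fin (order k)
encode zero    (hub true)          = zero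
encode zero    (pendant true)      = suc zero
encode zero    (hub false)         = suc (suc zero)
encode zero    (pendant false)     = suc (suc (suc zero))
encode (suc k) (port s (suc i))    = 3 ↑ʳ encode k (port s i)
encode (suc k) (middle (suc i))    = 3 ↑ʳ encode k (middle i)
encode (suc k) (port true zero)    = zero
encode (suc k) (middle zero)       = suc zero
encode (suc k) (port false zero)   = suc (suc zero)
encode (suc k) (hub s)             = 3 ↑ʳ encode k (hub s)
encode (suc k) (pendant s)         = 3 ↑ʳ encode k (pendant s)

encode-lift : ∀ k (p : Vertex k) → encode (suc k) (lift p) ≡ 3 ↑ʳ encode k p
encode-lift k (hub s)     = refl
encode-lift k (pendant s) = refl
encode-lift k (port s i)  = refl
encode-lift k (middle i)  = refl

decode-encode : ∀ k (p : Vertex k) → decode k (encode k p) ≡ p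
decode-encode zero    (hub true)        = refl
decode-encode zero    (pendant true)    = refl
decode-encode zero    (hub false)       = refl
decode-encode zero    (pendant false)   = refl
decode-encode (suc k) (port s (suc i))  = cong lift (decode-encode k (port s i))
decode-encode (suc k) (middle (suc i))  = cong lift (decode-encode k (middle i))
decode-encode (suc k) (port true zero)  = refl
decode-encode (suc k) (middle zero)     = refl
decode-encode (suc k) (port false zero) = refl
decode-encode (suc k) (hub s)           = cong lift (decode-encode k (hub s))
decode-encode (suc k) (pendant s)       = cong lift (decode-encode k (pendant s))

encode-decode : ∀ k (v : Fin (order k)) → encode k (decode k v) ≡ v
encode-decode zero    zero                   = refl
encode-decode zero    (suc zero)             = refl
encode-decode zero    (suc (suc zero))       = refl
encode-decode zero    (suc (suc (suc zero))) = refl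
encode-decode (suc k) zero                   = refl
encode-decode (suc k) (suc zero)             = refl
encode-decode (suc k) (suc (suc zero))       = refl
encode-decode (suc k) (suc (suc (suc v)))    =
  trans (encode-lift k (decode k v)) (cong (3 ↑ʳ_) (encode-decode k v))

arc : ∀ {k} → Vertex k → Vertex k → Bool
arc (hub s)    (pendant t) = does (s ≟ᵇ t)
arc (hub s)    (port t _)  = does (s ≟ᵇ t)
arc (port _ i) (middle j)  = does (i ≟ j)
arc _          _           = false

arc-loopless : ∀ {k} (p : Vertex k) → arc p p ≡ false
arc-loopless (hub s)     = refl
arc-loopless (pendant s) = refl
arc-loopless (port s i)  = refl
arc-loopless (middle i)  = refl

arc-lift : ∀ {k} (p q : Vertex k) → arc (lift p) (lift q) ≡ arc p q
arc-lift (hub s)     (hub t)     = refl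
arc-lift (hub s)     (pendant t) = refl
arc-lift (hub s)     (port t j)  = refl
arc-lift (hub s)     (middle j)  = refl
arc-lift (pendant s) q           = refl
arc-lift (port s i)  (hub t)     = refl
arc-lift (port s i)  (pendant t) = refl
arc-lift (port s i)  (port t j)  = refl
arc-lift (port s i)  (middle j)  = refl
arc-lift (middle i)  q           = refl

Theta : ∀ k → Graph (order k)
Theta k = fromArcs (λ u v → arc (decode k u) (decode k v)) (arc-loopless ∘ decode k)

Theta-edge⁻ : ∀ k {i j} → Edge (Theta k) i j →
  arc (decode k i) (decode k j) ≡ true ⊎ arc (decode k j) (decode k i) ≡ true
Theta-edge⁻ k = fromArcs-edge⁻ (λ u v → arc (decode k u) (decode k v)) (arc-loopless ∘ decode k)

Theta-edge : ∀ k (p q : Vertex k) → arc p q ≡ true → Edge (Theta k) (encode k p) (encode k q)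
Theta-edge k p q p→q rewrite decode-encode k p | decode-encode k q | p→q = refl

zero∈⊎one∈⇒∣p∣<∣x∷y∷p∣ : ∀ {n x y} {p : Subset n} →
  zero ∈ x ∷ y ∷ p ⊎ suc zero ∈ x ∷ y ∷ p → ∣ p ∣ < ∣ x ∷ y ∷ p ∣
zero∈⊎one∈⇒∣p∣<∣x∷y∷p∣ {y = y} {p = p} (inj₁ here)         = s≤s (∣p∣≤∣x∷p∣ y p)
zero∈⊎one∈⇒∣p∣<∣x∷y∷p∣ {x = x} {p = p} (inj₂ (there here)) = ∣p∣≤∣x∷p∣ x (inside ∷ p)

Theta-cover-restrict : ∀ k {x y z} (S : Subset (order k)) →
  IsVertexCover (Theta (suc k)) (x ∷ y ∷ z ∷ S) → IsVertexCover (Theta k) S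
Theta-cover-restrict k S cover i j e =
  Sum.map (drop-there ∘ drop-there ∘ drop-there) (drop-there ∘ drop-there ∘ drop-there)
    (cover (3 ↑ʳ i) (3 ↑ʳ j) (trans adj-lift e))
  where
  adj-lift : adj (Theta (suc k)) (3 ↑ʳ i) (3 ↑ʳ j) ≡ adj (Theta k) i j
  adj-lift = cong₂ _∨_ (arc-lift (decode k i) (decode k j)) (arc-lift (decode k j) (decode k i))

Theta-τ≥ : ∀ k (S : Subset (order k)) → IsVertexCover (Theta k) S → 2 + k ≤ ∣ S ∣
Theta-τ≥ zero (x ∷ y ∷ z ∷ w ∷ []) cover = ≤-trans
  (s≤s (zero∈⊎one∈⇒∣p∣<∣x∷y∷p∣ (Sum.map (drop-there ∘ drop-there) (drop-there ∘ drop-there)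
    (cover (suc (suc zero)) (suc (suc (suc zero))) refl))))
  (zero∈⊎one∈⇒∣p∣<∣x∷y∷p∣ (cover zero (suc zero) refl))
Theta-τ≥ (suc k) (x ∷ y ∷ z ∷ S) cover = ≤-trans
  (s≤s (≤-trans (Theta-τ≥ k S (Theta-cover-restrict k S cover)) (∣p∣≤∣x∷p∣ z S)))
  (zero∈⊎one∈⇒∣p∣<∣x∷y∷p∣ (cover zero (suc zero) refl))

hubsAndMiddles : ∀ k → Subset (order k)
hubsAndMiddles zero    = inside ∷ outside ∷ inside ∷ outside ∷ []
hubsAndMiddles (suc k) = outside ∷ inside ∷ outside ∷ hubsAndMiddles k

∣hubsAndMiddles∣ : ∀ k → ∣ hubsAndMiddles k ∣ ≡ 2 + k
∣hubsAndMiddles∣ zero    = refl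
∣hubsAndMiddles∣ (suc k) = cong suc (∣hubsAndMiddles∣ k)

hub∈hubsAndMiddles : ∀ k s → encode k (hub s) ∈ hubsAndMiddles k
hub∈hubsAndMiddles zero    true  = here
hub∈hubsAndMiddles zero    false = there (there here)
hub∈hubsAndMiddles (suc k) s     = there (there (there (hub∈hubsAndMiddles k s)))

middle∈hubsAndMiddles : ∀ k i → encode k (middle i) ∈ hubsAndMiddles k
middle∈hubsAndMiddles (suc k) zero    = there here
middle∈hubsAndMiddles (suc k) (suc i) = there (there (there (middle∈hubsAndMiddles k i)))

arc-covered : ∀ k (p q : Vertex k) → arc p q ≡ true →
  encode k p ∈ hubsAndMiddles k ⊎ encode k q ∈ hubsAndMiddles k
arc-covered k (hub s)     q           _  = inj₁ (hub∈hubsAndMiddles k s)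
arc-covered k (port s i)  (middle j)  _  = inj₂ (middle∈hubsAndMiddles k j)
arc-covered k (pendant s) q           ()
arc-covered k (port s i)  (hub t)     ()
arc-covered k (port s i)  (pendant t) ()
arc-covered k (port s i)  (port t j)  ()
arc-covered k (middle i)  q           ()

hubsAndMiddles-isVertexCover : ∀ k → IsVertexCover (Theta k) (hubsAndMiddles k)
hubsAndMiddles-isVertexCover k i j e =
  Sum.[ covered i j , Sum.swap ∘ covered j i ]′ (Theta-edge⁻ k e)
  where
  covered : ∀ u v → arc (decode k u) (decode k v) ≡ true →
    u ∈ hubsAndMiddles k ⊎ v ∈ hubsAndMiddles k
  covered u v a = subst₂ (λ u′ v′ → u′ ∈ hubsAndMiddles k ⊎ v′ ∈ hubsAndMiddles k)
    (encode-decode k u) (encode-decode k v) (arc-covered k (decode k u) (decode k v) a)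

Theta-τ : ∀ k → IsVertexCoverNumber (Theta k) (2 + k)
Theta-τ k =
  (hubsAndMiddles k , hubsAndMiddles-isVertexCover k , ∣hubsAndMiddles∣ k) , Theta-τ≥ k

module ThetaCut {k} (c : Vec Bool k) where

  shore : Vertex k → Bool
  shore (hub s)     = s
  shore (pendant s) = s
  shore (port s _)  = s
  shore (middle i)  = lookup c i

  side : Fin (order k) → Bool
  side = shore ∘ decode k

  cut : EdgeSet (order k)
  cut = cutOf (Theta k) side

  side-encode : ∀ p → side (encode k p) ≡ shore p
  side-encode p = cong shore (decode-encode k p)

  -- Only ports and middles meet a crossing arc, so mate is junk on hubs and pendants.
  mate : Vertex k → Vertex k
  mate (port _ i) = middle i
  mate (middle i) = port (not (lookup c i)) i
  mate p          = p

  crossingArc : ∀ p q → arc p q ≡ true → shore p ≢ shore q → q ≡ mate p × p ≡ mate q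
  crossingArc (hub s)     (pendant t) s→t s≢t = contradiction (does-true (s ≟ᵇ t) s→t) s≢t
  crossingArc (hub s)     (port t _)  s→t s≢t = contradiction (does-true (s ≟ᵇ t) s→t) s≢t
  crossingArc (port s i)  (middle j)  i→j s≢cⱼ with does-true (i ≟ j) i→j
  ... | refl = refl , cong (λ t → port t i) (¬-not s≢cⱼ)
  crossingArc (hub s)     (hub t)     ()
  crossingArc (hub s)     (middle j)  ()
  crossingArc (pendant s) q           ()
  crossingArc (port s i)  (hub t)     ()
  crossingArc (port s i)  (pendant t) ()
  crossingArc (port s i)  (port t j)  ()
  crossingArc (middle i)  q           ()

  cut-isMatching : IsMatching cut
  cut-isMatching i j l i~j i~l = trans (toMate i j i~j) (≡.sym (toMate i l i~l))
    where
    toMate : ∀ i j → InM cut i j → j ≡ encode k (mate (decode k i))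
    toMate i j i~j =
      trans (≡.sym (encode-decode k j)) (cong (encode k) (partner (Theta-edge⁻ k (proj₁ crossing))))
      where
      crossing : Edge (Theta k) i j × side i ≢ side j
      crossing = proj₁ (∧-xor≡true⇔ (adj (Theta k) i j) (side i) (side j)) i~j
      partner : arc (decode k i) (decode k j) ≡ true ⊎ arc (decode k j) (decode k i) ≡ true →
        decode k j ≡ mate (decode k i)
      partner (inj₁ i→j) = proj₁ (crossingArc (decode k i) (decode k j) i→j (proj₂ crossing))
      partner (inj₂ j→i) = proj₂ (crossingArc (decode k j) (decode k i) j→i (proj₂ crossing ∘ ≡.sym))

  hubVertex : Bool → Fin (order k)
  hubVertex s = encode k (hub s)

  againstArc : ∀ p q → arc q p ≡ true → shore p ≡ shore q →
    ShoreEdge (Theta k) side (encode k p) (encode k q)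
  againstArc p q q→p same = Edge-sym (Theta k) (Theta-edge k q p q→p) ,
    trans (side-encode p) (trans same (≡.sym (side-encode q)))

  walkToHub : ∀ p → Star (ShoreEdge (Theta k) side) (encode k p) (hubVertex (shore p))
  walkToHub (hub s)     = ε
  walkToHub (pendant s) = againstArc (pendant s) (hub s) (dec-true (s ≟ᵇ s) refl) refl ◅ ε
  walkToHub (port s i)  = againstArc (port s i) (hub s) (dec-true (s ≟ᵇ s) refl) refl ◅ ε
  walkToHub (middle i)  = againstArc (middle i) (port (lookup c i) i) (dec-true (i ≟ i) refl) refl
                        ◅ walkToHub (port (lookup c i) i)

  cut-isMinimal : IsMinimalMatchingCut (Theta k) cut
  cut-isMinimal = (cut-isMatching , side , isCut) , λ { M′ (_ , side′ , cut′) →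
    connectedShores⇒minimalCut (Theta k) side hubVertex walk side′ M′ cut′ }
    where
    isCut : IsCutOf (Theta k) side cut
    isCut = cutOf-isCut (Theta k) side
      (hubVertex true , side-encode (hub true)) (hubVertex false , side-encode (hub false))

    walk : ∀ v → Star (ShoreEdge (Theta k) side) v (hubVertex (side v))
    walk v = subst (λ u → Star (ShoreEdge (Theta k) side) u (hubVertex (side v)))
      (encode-decode k v) (walkToHub (decode k v))

  cut-port-middle : ∀ i → cut (encode k (port true i)) (encode k (middle i)) ≡ not (lookup c i)
  cut-port-middle i
    rewrite decode-encode k (port true i) | decode-encode k (middle i) | dec-true (i ≟ i) refl = refl

ThetaCut-injective : ∀ {k} {c d : Vec Bool k} → c ≢ d → DifferentE (ThetaCut.cut c) (ThetaCut.cut d)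
ThetaCut-injective {k} {c} {d} c≢d same = c≢d (begin
  c                   ≡⟨ ≡.sym (tabulate∘lookup c) ⟩
  tabulate (lookup c) ≡⟨ tabulate-cong lookups-agree ⟩
  tabulate (lookup d) ≡⟨ tabulate∘lookup d ⟩
  d                   ∎)
  where
  open ≡-Reasoning
  lookups-agree : ∀ i → lookup c i ≡ lookup d i
  lookups-agree i = not-injective (begin
    not (lookup c i)                                              ≡⟨ ≡.sym (ThetaCut.cut-port-middle c i) ⟩
    ThetaCut.cut c (encode k (port true i)) (encode k (middle i)) ≡⟨ same _ _ ⟩
    ThetaCut.cut d (encode k (port true i)) (encode k (middle i)) ≡⟨ ThetaCut.cut-port-middle d i ⟩
    not (lookup d i)                                              ∎)

proposition17 : Σ ℕ λ d → ∀ (k : ℕ) →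
    Σ ℕ λ n → Σ (Graph n) λ G → Σ ℕ λ t →
      IsVertexCoverNumber G t × k ≤ t ×
      Σ (List (EdgeSet n)) λ L →
        All (IsMinimalMatchingCut G) L × AllPairs DifferentE L ×
        2 ^ t ≤ d * length L
proposition17 = 4 , λ k → let cs = booleanVectors k in
  order k , Theta k , 2 + k , Theta-τ k , m≤n+m k 2 ,
  map ThetaCut.cut cs ,
  All.map⁺ (All.universal ThetaCut.cut-isMinimal cs) ,
  AllPairs.map⁺ (AllPairs.map ThetaCut-injective (booleanVectors-distinct k)) ,
  ≤-reflexive (begin
    2 ^ (2 + k)                      ≡⟨ ^-distribˡ-+-* 2 2 k ⟩
    4 * 2 ^ k                        ≡⟨ cong (4 *_) (≡.sym (length-booleanVectors k)) ⟩
    4 * length cs                    ≡⟨ cong (4 *_) (≡.sym (length-map ThetaCut.cut cs)) ⟩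
    4 * length (map ThetaCut.cut cs) ∎)
  where open ≡-Reasoning
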